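{- For every relevant modal logic $\mathsf{L}$ (determined by a set $\Phi$ of frame conditions from the table below) and every formula $\varphi$: $\varphi$ is provable in the axiom system $\mathsf{L}$ if and only if $\Box_L\varphi$ is provable in the axiom system $\mathsf{CL}$.
   Context: Language: a countable set $Pr$ of propositional variables, binary connectives $\land,\lor,\to$ and unary connectives $\neg,\Box,\Box_L$; $\varphi\leftrightarrow\psi:=(\varphi\to\psi)\land(\psi\to\varphi)$. Frame conditions and corresponding axioms/rules (the conditions are only needed to identify which logics $\mathsf{L}$ are considered; $Rstuv:=\exists x(Rstx\,\&\,Rxuv)$, $Rs(tu)v:=\exists x(Rtux\,\&\,Rsxv)$, $RQstu:=\exists x(Rstx\,\&\,Qxu)$, $QRstu:=\exists x(Qsx\,\&\,Rxtu)$, for a ternary $R$, binary $Q$, unary $*$, order $\le$, distinguished set $L$): (DN) $s^{**}=s$ / $p\leftrightarrow\neg\neg p$; (Cp) $Rstu\Rightarrow Rsu^*t^*$ / $(p\to q)\to(\neg q\to\neg p)$; (WB) $Rstu\Rightarrow Rs(st)u$ / $((p\to q)\land(q\to r))\to(p\to r)$; (X) $s\in L\Rightarrow s^*\le s$ / $p\lor\neg p$; (Rd) $Rss^*s$ / $(p\to\neg p)\to\neg p$; (B) $Rstuv\Rightarrow Rs(tu)v$ / $(p\to q)\to((r\to p)\to(r\to q))$; (CB) $Rstuv\Rightarrow Rt(su)v$ / $(p\to q)\to((q\to r)\to(p\to r))$; (W) $Rstu\Rightarrow Rsttu$ / $(p\to(p\to q))\to(p\to q)$; (C) $Rstuv\Rightarrow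 Rsutv$ / $(p\to(q\to r))\to(q\to(p\to r))$; (M) $Rstu\Rightarrow(s\le u$ or $t\le u)$ / $p\to(p\to p)$; (ER) $\exists x(x\in L\,\&\,Rsxs)$ / rule: from $\varphi$ infer $(\varphi\to\psi)\to\psi$; (Nec) $(x\in L\,\&\,Qxs)\Rightarrow s\in L$ / rule: from $\varphi$ infer $\Box\varphi$; ($\Box$K) $RQstu\Rightarrow\exists x(Qtx\,\&\,QRsxu)$ / $\Box(p\to q)\to(\Box p\to\Box q)$; ($\Box$T) $Qss$ / $\Box p\to p$; ($\Box$D) $\exists x(Qsx^*\,\&\,Qs^*x)$ / $\Box\neg p\to\neg\Box p$; ($\Box$4) $(Qst\,\&\,Qtu)\Rightarrow Qsu$ / $\Box p\to\Box\Box p$; ($\Box$5) $(Qs^*u\,\&\,Qst)\Rightarrow Qt^*u$ / $\neg\Box p\to\Box\neg\Box p$. The axiom system $\mathsf{L}$ is $\mathsf{BM.C}$ plus the axioms/rules corresponding to the chosen set $\Phi$, where $\mathsf{BM.C}$ has axioms $p\to p$; $\neg(p\land q)\to(\neg p\lor\neg q)$; $(\neg p\land\neg q)\to\neg(p\lor q)$; $(p\land q)\to p$; $(p\land q)\to q$; $p\to(p\lor q)$; $q\to(p\lor q)$; $((p\to q)\land(p\to r))\to(p\to(q\land r))$; $((p\to r)\land(q\to r))\to((p\lor q)\to r)$; $(p\land(q\lor r))\to((p\land q)\lor(p\land r))$; $(\Box p\land\Box q)\to\Box(p\land q)$; $(\Box_Lp\land\Box_Lq)\to\Box_L(p\land q)$;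 rules: uniform substitution, modus ponens, adjunction ($\varphi,\psi/\varphi\land\psi$), affixing ($\varphi'\to\varphi,\ \psi\to\psi'/(\varphi\to\psi)\to(\varphi'\to\psi')$), contraposition ($\varphi\to\psi/\neg\psi\to\neg\varphi$), $\Box$-monotonicity ($\varphi\to\psi/\Box\varphi\to\Box\psi$), $\Box_L$-monotonicity ($\varphi\to\psi/\Box_L\varphi\to\Box_L\psi$). The axiom system $\mathsf{CL}$ consists of: classical propositional logic (all substitution instances over the full language, $\neg,\to,\land,\lor$ read classically), modus ponens, uniform substitution; an axiom $\Box_L\varphi$ for each axiom $\varphi$ of $\mathsf{L}$; for each inference rule $\varphi_1,\dots,\varphi_n/\psi$ of $\mathsf{L}$, the rule $\Box_L\varphi_1,\dots,\Box_L\varphi_n/\Box_L\psi$; and the Bridge Rule: from $\Box_L(\varphi\to\psi)$ infer $\varphi\to\psi$. -}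

module Defs where

open import Data.Nat using (ℕ)
open import Data.Bool using (Bool; true; false; _∧_; _∨_; not)
open import Data.Product using (Σ; _×_; _,_)
open import Data.Sum using (_⊎_)
open import Relation.Binary.PropositionalEquality using (_≡_)

infixr 6 _∧'_
infixr 5 _∨'_
infixr 4 _⇒_

data Formula : Set where
  var  : ℕ → Formula
  _∧'_ : Formula → Formula → Formula
  _∨'_ : Formula → Formula → Formula
  _⇒_  : Formula → Formula → Formula
  ¬'   : Formula → Formula
  □    : Formula → Formula
  □L   : Formula → Formula

_⇔'_ : Formula → Formula → Formula
φ ⇔' ψ = (φ ⇒ ψ) ∧' (ψ ⇒ φ)

_[_] : Formula → (ℕ → Formula) → Formula
var n    [ σ ] = σ n
(φ ∧' ψ) [ σ ] = (φ [ σ ]) ∧' (ψ [ σ ])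
(φ ∨' ψ) [ σ ] = (φ [ σ ]) ∨' (ψ [ σ ])
(φ ⇒ ψ)  [ σ ] = (φ [ σ ]) ⇒ (ψ [ σ ])
¬' φ     [ σ ] = ¬' (φ [ σ ])
□ φ      [ σ ] = □ (φ [ σ ])
□L φ     [ σ ] = □L (φ [ σ ])

p q r : Formula
p = var 0
q = var 1
r = var 2

-- Frame conditions (the table); a logic is determined by Φ : Cond → Bool

data Cond : Set where
  DN Cp WB X Rd B CB W C M ER Nec □K □T □D □4 □5 : Cond

data BMCAx : Formula → Set where
  a1  : BMCAx (p ⇒ p)
  a2  : BMCAx (¬' (p ∧' q) ⇒ (¬' p ∨' ¬' q))
  a3  : BMCAx ((¬' p ∧' ¬' q) ⇒ ¬' (p ∨' q))
  a4  : BMCAx ((p ∧' q) ⇒ p)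
  a5  : BMCAx ((p ∧' q) ⇒ q)
  a6  : BMCAx (p ⇒ (p ∨' q))
  a7  : BMCAx (q ⇒ (p ∨' q))
  a8  : BMCAx (((p ⇒ q) ∧' (p ⇒ r)) ⇒ (p ⇒ (q ∧' r)))
  a9  : BMCAx (((p ⇒ r) ∧' (q ⇒ r)) ⇒ ((p ∨' q) ⇒ r))
  a10 : BMCAx ((p ∧' (q ∨' r)) ⇒ ((p ∧' q) ∨' (p ∧' r)))
  a11 : BMCAx ((□ p ∧' □ q) ⇒ □ (p ∧' q))
  a12 : BMCAx ((□L p ∧' □L q) ⇒ □L (p ∧' q))

-- Axioms corresponding to frame conditions (ER and Nec correspond to rules)
data CondAx : Cond → Formula → Set where
  axDN : CondAx DN (p ⇔' ¬' (¬' p))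
  axCp : CondAx Cp ((p ⇒ q) ⇒ (¬' q ⇒ ¬' p))
  axWB : CondAx WB (((p ⇒ q) ∧' (q ⇒ r)) ⇒ (p ⇒ r))
  axX  : CondAx X (p ∨' ¬' p)
  axRd : CondAx Rd ((p ⇒ ¬' p) ⇒ ¬' p)
  axB  : CondAx B ((p ⇒ q) ⇒ ((r ⇒ p) ⇒ (r ⇒ q)))
  axCB : CondAx CB ((p ⇒ q) ⇒ ((q ⇒ r) ⇒ (p ⇒ r)))
  axW  : CondAx W ((p ⇒ (p ⇒ q)) ⇒ (p ⇒ q))
  axC  : CondAx C ((p ⇒ (q ⇒ r)) ⇒ (q ⇒ (p ⇒ r)))
  axM  : CondAx M (p ⇒ (p ⇒ p))
  ax□K : CondAx □K (□ (p ⇒ q) ⇒ (□ p ⇒ □ q))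
  ax□T : CondAx □T (□ p ⇒ p)
  ax□D : CondAx □D (□ (¬' p) ⇒ ¬' (□ p))
  ax□4 : CondAx □4 (□ p ⇒ □ (□ p))
  ax□5 : CondAx □5 (¬' (□ p) ⇒ □ (¬' (□ p)))

LAx : (Cond → Bool) → Formula → Set
LAx Φ φ = BMCAx φ ⊎ Σ Cond (λ c → (Φ c ≡ true) × CondAx c φ)

data Rule₁ (Φ : Cond → Bool) : Formula → Formula → Set where
  us       : ∀ φ (σ : ℕ → Formula) → Rule₁ Φ φ (φ [ σ ])
  contrap  : ∀ φ ψ → Rule₁ Φ (φ ⇒ ψ) (¬' ψ ⇒ ¬' φ)
  □mono    : ∀ φ ψ → Rule₁ Φ (φ ⇒ ψ) (□ φ ⇒ □ ψ)
  □Lmono   : ∀ φ ψ → Rule₁ Φ (φ ⇒ ψ) (□L φ ⇒ □L ψ)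
  er       : Φ ER ≡ true → ∀ φ ψ → Rule₁ Φ φ ((φ ⇒ ψ) ⇒ ψ)
  nec      : Φ Nec ≡ true → ∀ φ → Rule₁ Φ φ (□ φ)

data Rule₂ (Φ : Cond → Bool) : Formula → Formula → Formula → Set where
  mp     : ∀ φ ψ → Rule₂ Φ φ (φ ⇒ ψ) ψ
  adj    : ∀ φ ψ → Rule₂ Φ φ ψ (φ ∧' ψ)
  affix  : ∀ φ φ' ψ ψ' → Rule₂ Φ (φ' ⇒ φ) (ψ ⇒ ψ') ((φ ⇒ ψ) ⇒ (φ' ⇒ ψ'))

data L⊢ (Φ : Cond → Bool) : Formula → Set where
  ax    : ∀ {φ} → LAx Φ φ → L⊢ Φ φ
  rule₁ : ∀ {φ ψ} → Rule₁ Φ φ ψ → L⊢ Φ φ → L⊢ Φ ψ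
  rule₂ : ∀ {φ₁ φ₂ ψ} → Rule₂ Φ φ₁ φ₂ ψ → L⊢ Φ φ₁ → L⊢ Φ φ₂ → L⊢ Φ ψ

data IsProp : Formula → Set where
  pvar : ∀ n → IsProp (var n)
  pand : ∀ {φ ψ} → IsProp φ → IsProp ψ → IsProp (φ ∧' ψ)
  por  : ∀ {φ ψ} → IsProp φ → IsProp ψ → IsProp (φ ∨' ψ)
  pimp : ∀ {φ ψ} → IsProp φ → IsProp ψ → IsProp (φ ⇒ ψ)
  pneg : ∀ {φ} → IsProp φ → IsProp (¬' φ)

-- classical evaluation (modal subformulas are irrelevant for IsProp formulas)
eval : (ℕ → Bool) → Formula → Bool
eval v (var n)  = v n
eval v (φ ∧' ψ) = eval v φ ∧ eval v ψ
eval v (φ ∨' ψ) = eval v φ ∨ eval v ψ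
eval v (φ ⇒ ψ)  = not (eval v φ) ∨ eval v ψ
eval v (¬' φ)   = not (eval v φ)
eval v (□ φ)    = false
eval v (□L φ)   = false

Tautology : Formula → Set
Tautology τ = IsProp τ × (∀ (v : ℕ → Bool) → eval v τ ≡ true)

CPC : Formula → Set
CPC φ = Σ Formula (λ τ → Σ (ℕ → Formula) (λ σ → Tautology τ × (φ ≡ τ [ σ ])))

data CL⊢ (Φ : Cond → Bool) : Formula → Set where
  cpc    : ∀ {φ} → CPC φ → CL⊢ Φ φ
  mp     : ∀ {φ ψ} → CL⊢ Φ φ → CL⊢ Φ (φ ⇒ ψ) → CL⊢ Φ ψ
  us     : ∀ {φ} (σ : ℕ → Formula) → CL⊢ Φ φ → CL⊢ Φ (φ [ σ ])
  axL    : ∀ {φ} → LAx Φ φ → CL⊢ Φ (□L φ)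
  rule₁L : ∀ {φ ψ} → Rule₁ Φ φ ψ → CL⊢ Φ (□L φ) → CL⊢ Φ (□L ψ)
  rule₂L : ∀ {φ₁ φ₂ ψ} → Rule₂ Φ φ₁ φ₂ ψ →
           CL⊢ Φ (□L φ₁) → CL⊢ Φ (□L φ₂) → CL⊢ Φ (□L ψ)
  bridge : ∀ {φ ψ} → CL⊢ Φ (□L (φ ⇒ ψ)) → CL⊢ Φ (φ ⇒ ψ)

{-# OPTIONS --safe #-}
-- A CL-derivation of □L φ can only come from an L-derivation of φ, because □L reads
-- as L-provability.  To make this precise, fix an answer type R and interpret formulas
-- as types by a double-negation translation with ¬ A := A → R, reading □ as the
-- identity and □L θ as ¬¬ (L ⊢ θ).  Every L-theorem is then true, hence so is every
-- instance of the Bridge Rule; every interpretation is ¬¬-stable, hence classical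
-- tautologies are true as well.  So every CL-theorem is true, and for R := (L ⊢ φ)
-- the truth of □L φ, a term of ((L ⊢ φ) → R) → R, gives L ⊢ φ.
module Submission where

open import Defs
open import Data.Bool using (Bool; true; false; _∧_; _∨_; not)
open import Data.Empty using (⊥-elim)
open import Data.Nat using (ℕ; zero; suc; _<_; _⊔_; _≟_)
open import Data.Nat.Properties using (m<1+n⇒m<n∨m≡n; m<n⇒m<n⊔o; m<n⇒m<o⊔n; n<1+n)
open import Data.Product using (Σ; _×_; _,_; proj₁; proj₂)
open import Data.Sum using (_⊎_; inj₁; inj₂)
open import Data.Unit using (⊤; tt)
open import Function using (_∘_; id)
open import Function.Bundles using (_⇔_; mk⇔)
open import Relation.Nullary using (yes; no)
open import Relation.Binary.PropositionalEquality using (_≡_; refl; sym; cong; cong₂; subst)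

[]-[] : ∀ θ (σ τ : ℕ → Formula) → (θ [ σ ]) [ τ ] ≡ θ [ (λ n → σ n [ τ ]) ]
[]-[] (var n)  σ τ = refl
[]-[] (a ∧' b) σ τ = cong₂ _∧'_ ([]-[] a σ τ) ([]-[] b σ τ)
[]-[] (a ∨' b) σ τ = cong₂ _∨'_ ([]-[] a σ τ) ([]-[] b σ τ)
[]-[] (a ⇒ b)  σ τ = cong₂ _⇒_ ([]-[] a σ τ) ([]-[] b σ τ)
[]-[] (¬' a)   σ τ = cong ¬' ([]-[] a σ τ)
[]-[] (□ a)    σ τ = cong □ ([]-[] a σ τ)
[]-[] (□L a)   σ τ = cong □L ([]-[] a σ τ)

[]-var : ∀ θ → θ [ var ] ≡ θ
[]-var (var n)  = refl
[]-var (a ∧' b) = cong₂ _∧'_ ([]-var a) ([]-var b)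
[]-var (a ∨' b) = cong₂ _∨'_ ([]-var a) ([]-var b)
[]-var (a ⇒ b)  = cong₂ _⇒_ ([]-var a) ([]-var b)
[]-var (¬' a)   = cong ¬' ([]-var a)
[]-var (□ a)    = cong □ ([]-var a)
[]-var (□L a)   = cong □L ([]-var a)

varBound : ∀ {τ} → IsProp τ → ℕ
varBound (pvar n)   = suc n
varBound (pand a b) = varBound a ⊔ varBound b
varBound (por a b)  = varBound a ⊔ varBound b
varBound (pimp a b) = varBound a ⊔ varBound b
varBound (pneg a)   = varBound a

module _ {Φ : Cond → Bool} where

  L⊢-[] : ∀ {θ} σ → L⊢ Φ θ → L⊢ Φ (θ [ σ ])
  L⊢-[] {θ} σ = rule₁ (us θ σ)

  L⊢-[var] : ∀ {θ} → L⊢ Φ (θ [ var ]) → L⊢ Φ θ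
  L⊢-[var] {θ} = subst (L⊢ Φ) ([]-var θ)

  L⊢⇒CL⊢□L : ∀ {φ} → L⊢ Φ φ → CL⊢ Φ (□L φ)
  L⊢⇒CL⊢□L (ax a)        = axL a
  L⊢⇒CL⊢□L (rule₁ r d)   = rule₁L r (L⊢⇒CL⊢□L d)
  L⊢⇒CL⊢□L (rule₂ r d e) = rule₂L r (L⊢⇒CL⊢□L d) (L⊢⇒CL⊢□L e)

module DoubleNegation (R : Set) where

  ¬R : Set → Set
  ¬R A = A → R

  ¬¬R : Set → Set
  ¬¬R A = ¬R (¬R A)

  Stable : Set → Set
  Stable A = ¬¬R A → A

  ¬R-stable : ∀ A → Stable (¬R A)
  ¬R-stable A ¬¬¬a a = ¬¬¬a (λ ¬a → ¬a a)

  return : ∀ {A} → A → ¬¬R A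
  return a k = k a

  _>>=_ : ∀ {A B} → ¬¬R A → (A → ¬¬R B) → ¬¬R B
  (m >>= f) k = m (λ a → f a k)

  excluded-middle : ∀ A → ¬¬R (A ⊎ ¬R A)
  excluded-middle A k = k (inj₂ (k ∘ inj₁))

  data Reflects (A : Set) : Bool → Set where
    ofʸ : A → Reflects A true
    ofⁿ : ¬R A → Reflects A false

  Reflects-× : ∀ {A B x y} → Reflects A x → Reflects B y → Reflects (A × B) (x ∧ y)
  Reflects-× (ofʸ a)  (ofʸ b)  = ofʸ (a , b)
  Reflects-× (ofʸ _)  (ofⁿ ¬b) = ofⁿ (¬b ∘ proj₂)
  Reflects-× (ofⁿ ¬a) _        = ofⁿ (¬a ∘ proj₁)

  Reflects-⊎ : ∀ {A B x y} → Reflects A x → Reflects B y → Reflects (¬¬R (A ⊎ B)) (x ∨ y)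
  Reflects-⊎ (ofʸ a)  _        = ofʸ (return (inj₁ a))
  Reflects-⊎ (ofⁿ _)  (ofʸ b)  = ofʸ (return (inj₂ b))
  Reflects-⊎ (ofⁿ ¬a) (ofⁿ ¬b) = ofⁿ (λ ¬¬a⊎b → ¬¬a⊎b λ { (inj₁ a) → ¬a a ; (inj₂ b) → ¬b b })

  Reflects-→ : ∀ {A B x y} → Stable B → Reflects A x → Reflects B y → Reflects (A → B) (not x ∨ y)
  Reflects-→ _      (ofʸ _)  (ofʸ b)  = ofʸ (λ _ → b)
  Reflects-→ _      (ofʸ a)  (ofⁿ ¬b) = ofⁿ (λ f → ¬b (f a))
  Reflects-→ stable (ofⁿ ¬a) _        = ofʸ (λ a → stable (λ _ → ¬a a))

  Reflects-¬ : ∀ {A x} → Reflects A x → Reflects (¬R A) (not x)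
  Reflects-¬ (ofʸ a)  = ofⁿ (λ ¬a → ¬a a)
  Reflects-¬ (ofⁿ ¬a) = ofʸ ¬a

  Agrees : (ℕ → Bool) → (ℕ → Set) → ℕ → Set
  Agrees b u N = ∀ n → n < N → Reflects (u n) (b n)

  update : (ℕ → Bool) → ℕ → Bool → ℕ → Bool
  update b N x n with n ≟ N
  ... | yes _ = x
  ... | no  _ = b n

  Agrees-update : ∀ {b u N x} → Agrees b u N → Reflects (u N) x → Agrees (update b N x) u (suc N)
  Agrees-update {N = N} agrees reflects n n<1+N with n ≟ N | m<1+n⇒m<n∨m≡n n<1+N
  ... | yes refl | _          = reflects
  ... | no  _    | inj₁ n<N   = agrees n n<N
  ... | no  n≢N  | inj₂ n≡N   = ⊥-elim (n≢N n≡N)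

  -- Agreement on all of ℕ would need a ¬¬-choice principle; finitely many atoms suffice.
  agreeing-assignment : ∀ u N → ¬¬R (Σ (ℕ → Bool) λ b → Agrees b u N)
  agreeing-assignment u zero    = return ((λ _ → true) , λ _ ())
  agreeing-assignment u (suc N) = do
    (b , agrees) ← agreeing-assignment u N
    inj₁ uN ← excluded-middle (u N)
      where inj₂ ¬uN → return (update b N false , Agrees-update agrees (ofⁿ ¬uN))
    return (update b N true , Agrees-update agrees (ofʸ uN))

module Interpretation (Φ : Cond → Bool) (R : Set) (v : ℕ → Set) where
  open DoubleNegation R

  ⟦_⟧ : Formula → Set
  ⟦ var n  ⟧ = v n
  ⟦ a ∧' b ⟧ = ⟦ a ⟧ × ⟦ b ⟧
  ⟦ a ∨' b ⟧ = ¬¬R (⟦ a ⟧ ⊎ ⟦ b ⟧)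
  ⟦ a ⇒ b  ⟧ = ⟦ a ⟧ → ⟦ b ⟧
  ⟦ ¬' a   ⟧ = ¬R ⟦ a ⟧
  ⟦ □ a    ⟧ = ⟦ a ⟧
  ⟦ □L a   ⟧ = ¬¬R (L⊢ Φ a)

  module _ (v-stable : ∀ n → Stable (v n)) where

    ⟦⟧-stable : ∀ θ → Stable ⟦ θ ⟧
    ⟦⟧-stable (var n)  = v-stable n
    ⟦⟧-stable (a ∧' b) ¬¬ab = ⟦⟧-stable a (λ ¬a → ¬¬ab (¬a ∘ proj₁))
                            , ⟦⟧-stable b (λ ¬b → ¬¬ab (¬b ∘ proj₂))
    ⟦⟧-stable (a ∨' b) = ¬R-stable _
    ⟦⟧-stable (a ⇒ b)  ¬¬f x = ⟦⟧-stable b (λ ¬b → ¬¬f (λ f → ¬b (f x)))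
    ⟦⟧-stable (¬' a)   = ¬R-stable _
    ⟦⟧-stable (□ a)    = ⟦⟧-stable a
    ⟦⟧-stable (□L a)   = ¬R-stable _

    Reflects-eval : ∀ {τ} (prop : IsProp τ) σ {b} → Agrees b (⟦_⟧ ∘ σ) (varBound prop) →
                    Reflects ⟦ τ [ σ ] ⟧ (eval b τ)
    Reflects-eval (pvar n) σ agrees = agrees n (n<1+n n)
    Reflects-eval (pand a b) σ agrees =
      Reflects-× (Reflects-eval a σ (λ n → agrees n ∘ m<n⇒m<n⊔o _))
                 (Reflects-eval b σ (λ n → agrees n ∘ m<n⇒m<o⊔n _))
    Reflects-eval (por a b) σ agrees =
      Reflects-⊎ (Reflects-eval a σ (λ n → agrees n ∘ m<n⇒m<n⊔o _))
                 (Reflects-eval b σ (λ n → agrees n ∘ m<n⇒m<o⊔n _))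
    Reflects-eval (pimp {ψ = ψ} a b) σ agrees =
      Reflects-→ (⟦⟧-stable (ψ [ σ ]))
                 (Reflects-eval a σ (λ n → agrees n ∘ m<n⇒m<n⊔o _))
                 (Reflects-eval b σ (λ n → agrees n ∘ m<n⇒m<o⊔n _))
    Reflects-eval (pneg a) σ agrees = Reflects-¬ (Reflects-eval a σ agrees)

    tautology-true : ∀ {τ} → Tautology τ → ∀ σ → ⟦ τ [ σ ] ⟧
    tautology-true {τ} (prop , valid) σ = ⟦⟧-stable (τ [ σ ]) do
      (b , agrees) ← agreeing-assignment (⟦_⟧ ∘ σ) (varBound prop)
      return (true-of (subst (Reflects _) (valid b) (Reflects-eval prop σ agrees)))
      where true-of : ∀ {A} → Reflects A true → A
            true-of (ofʸ a) = a

    BMCAx-true : ∀ {θ} → BMCAx θ → ∀ σ → ⟦ θ [ σ ] ⟧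
    BMCAx-true a1  σ = id
    BMCAx-true a2  σ ¬ab k = k (inj₁ λ a → k (inj₂ λ b → ¬ab (a , b)))
    BMCAx-true a3  σ (¬a , ¬b) ¬¬a⊎b = ¬¬a⊎b λ { (inj₁ a) → ¬a a ; (inj₂ b) → ¬b b }
    BMCAx-true a4  σ = proj₁
    BMCAx-true a5  σ = proj₂
    BMCAx-true a6  σ = return ∘ inj₁
    BMCAx-true a7  σ = return ∘ inj₂
    BMCAx-true a8  σ (f , g) a = f a , g a
    BMCAx-true a9  σ (f , g) ¬¬a⊎b = ⟦⟧-stable (σ 2) do
      inj₁ a ← ¬¬a⊎b
        where inj₂ b → return (g b)
      return (f a)
    BMCAx-true a10 σ (a , ¬¬b⊎c) = do
      inj₁ b ← ¬¬b⊎c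
        where inj₂ c → return (inj₂ (a , c))
      return (inj₁ (a , b))
    BMCAx-true a11 σ = id
    BMCAx-true a12 σ (¬¬⊢a , ¬¬⊢b) = do
      ⊢a ← ¬¬⊢a
      ⊢b ← ¬¬⊢b
      return (rule₂ (adj _ _) ⊢a ⊢b)

    CondAx-true : ∀ {c θ} → CondAx c θ → ∀ σ → ⟦ θ [ σ ] ⟧
    CondAx-true axDN σ = return , ⟦⟧-stable (σ 0)
    CondAx-true axCp σ f ¬b = ¬b ∘ f
    CondAx-true axWB σ (f , g) = g ∘ f
    CondAx-true axX  σ = excluded-middle _
    CondAx-true axRd σ f a = f a a
    CondAx-true axB  σ f g = f ∘ g
    CondAx-true axCB σ f g = g ∘ f
    CondAx-true axW  σ f a = f a a
    CondAx-true axC  σ f b a = f a b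
    CondAx-true axM  σ a _ = a
    CondAx-true ax□K σ = id
    CondAx-true ax□T σ = id
    CondAx-true ax□D σ = id
    CondAx-true ax□4 σ = id
    CondAx-true ax□5 σ = id

    L⊢-true : ∀ {θ} → L⊢ Φ θ → ∀ σ → ⟦ θ [ σ ] ⟧
    L⊢-true (ax (inj₁ a))           = BMCAx-true a
    L⊢-true (ax (inj₂ (_ , _ , a))) = CondAx-true a
    L⊢-true (rule₁ (us θ σ′) d) σ   = subst ⟦_⟧ (sym ([]-[] θ σ′ σ)) (L⊢-true d _)
    L⊢-true (rule₁ (contrap _ _) d) σ ¬b = ¬b ∘ L⊢-true d σ
    L⊢-true (rule₁ (□mono _ _) d)   = L⊢-true d
    L⊢-true (rule₁ (□Lmono _ _) d) σ ¬¬⊢a = do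
      ⊢a ← ¬¬⊢a
      return (rule₂ (mp _ _) ⊢a (L⊢-[] σ d))
    L⊢-true (rule₁ (er _ _ _) d) σ f = f (L⊢-true d σ)
    L⊢-true (rule₁ (nec _ _) d)     = L⊢-true d
    L⊢-true (rule₂ (mp _ _) d e) σ  = L⊢-true e σ (L⊢-true d σ)
    L⊢-true (rule₂ (adj _ _) d e) σ = L⊢-true d σ , L⊢-true e σ
    L⊢-true (rule₂ (affix _ _ _ _) d e) σ f = L⊢-true e σ ∘ f ∘ L⊢-true d σ

    CL⊢-true : ∀ {θ} → CL⊢ Φ θ → ∀ σ → ⟦ θ [ σ ] ⟧
    CL⊢-true (cpc (τ , σ′ , t , refl)) σ = subst ⟦_⟧ (sym ([]-[] τ σ′ σ)) (tautology-true t _)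
    CL⊢-true (mp d e) σ = CL⊢-true e σ (CL⊢-true d σ)
    CL⊢-true (us {θ} σ′ d) σ = subst ⟦_⟧ (sym ([]-[] θ σ′ σ)) (CL⊢-true d _)
    CL⊢-true (axL a) σ = return (L⊢-[] σ (ax a))
    CL⊢-true (rule₁L r d) σ = do
      ⊢a ← CL⊢-true d var
      return (L⊢-[] σ (rule₁ r (L⊢-[var] ⊢a)))
    CL⊢-true (rule₂L r d e) σ = do
      ⊢a ← CL⊢-true d var
      ⊢b ← CL⊢-true e var
      return (L⊢-[] σ (rule₂ r (L⊢-[var] ⊢a) (L⊢-[var] ⊢b)))
    CL⊢-true (bridge {θ} {ψ} d) σ a = ⟦⟧-stable (ψ [ σ ]) do
      ⊢θ⇒ψ ← CL⊢-true d σ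
      return (subst ⟦_⟧ ([]-var ((θ ⇒ ψ) [ σ ])) (L⊢-true ⊢θ⇒ψ var) a)

CL⊢□L⇒L⊢ : ∀ {Φ φ} → CL⊢ Φ (□L φ) → L⊢ Φ φ
CL⊢□L⇒L⊢ {Φ} {φ} d = CL⊢-true (λ _ _ → tt) d var L⊢-[var]
  where open Interpretation Φ (L⊢ Φ φ) (λ _ → ⊤)

lemma5p3 : (Φ : Cond → Bool) (φ : Formula) → L⊢ Φ φ ⇔ CL⊢ Φ (□L φ)
lemma5p3 Φ φ = mk⇔ L⊢⇒CL⊢□L CL⊢□L⇒L⊢
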